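{- For every $G\subseteq A$ and every formula $\varphi\in\mathcal{L}_{CoRGAL}$, the formula $\langle[G]\rangle\langle[G]\rangle\varphi\to[\langle A\setminus G\rangle]\varphi$ is valid.
   Context: Fix a finite set $A$ of agents and a countable set $P$ of propositional variables. The language $\mathcal{L}_{CoRGAL}$ is given by $\varphi ::= p \mid \neg\varphi \mid (\varphi\wedge\varphi) \mid K_a\varphi \mid [\varphi]\varphi \mid [G,\varphi]\varphi \mid [\langle G\rangle]\varphi$ with $p\in P$, $a\in A$, $G\subseteq A$; $\langle\varphi\rangle\psi:=\neg[\varphi]\neg\psi$, $\langle[G]\rangle\varphi:=\neg[\langle G\rangle]\neg\varphi$. $\mathcal{L}_{EL}$ is the fragment built only from $p,\neg,\wedge,K_a$. For $G\subseteq A$, $\mathcal{L}_{EL}^G$ is the set of formulas $\bigwedge_{i\in G}K_i\varphi_i$ with each $\varphi_i\in\mathcal{L}_{EL}$; $\psi_G$ denotes an element of $\mathcal{L}_{EL}^G$, $\chi_{A\setminus G}$ one of $\mathcal{L}_{EL}^{A\setminus G}$. An epistemic model is $M=(W,\sim,V)$ with $W\neq\emptyset$, each $\sim_a$ an equivalence relation, $V:P\to\mathcal{P}(W)$. $M^\varphi$ is the restriction of $M$ to the states where $\varphi$ holds. Semantics: $p,\neg,\wedge$ as usual; $K_a\varphi$ true at $w$ iff $\varphi$ true at all $v\sim_a w$; $(M,w)\models[\varphi]\psi$ iff $(M,w)\models\varphi$ implies $(M^\varphi,w)\models\psi$; $(M,w)\models[G,\chi]\varphi$ iff $(M,w)\models\chi$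 and for all $\psi_G$, $(M,w)\models[\psi_G\wedge\chi]\varphi$; $(M,w)\models[\langle G\rangle]\varphi$ iff for all $\psi_G$ there is $\chi_{A\setminus G}$ with $(M,w)\models\psi_G\to\langle\psi_G\wedge\chi_{A\setminus G}\rangle\varphi$. Equivalently, $(M,w)\models\langle[G]\rangle\varphi$ iff there is $\psi_G$ such that for all $\chi_{A\setminus G}$, $(M,w)\models\psi_G\wedge[\psi_G\wedge\chi_{A\setminus G}]\varphi$. Valid means true at every pointed model. -}

module Defs where

open import Level using (0ℓ)
open import Data.Nat using (ℕ; zero)
open import Data.Fin using (Fin)
open import Data.Fin.Subset using (Subset; ∁)
open import Data.Fin.Subset.Properties using (_∈?_)
open import Data.List using (List; []; _∷_; map; filter; allFin)
open import Data.Product using (Σ; _×_; _,_; proj₁; proj₂)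
open import Relation.Nullary using (¬_)
open import Relation.Binary.Structures using (IsEquivalence)

data EL (n : ℕ) : Set where
  varₑ  : ℕ → EL n
  ¬ₑ_   : EL n → EL n
  _∧ₑ_  : EL n → EL n → EL n
  Kₑ    : Fin n → EL n → EL n

data Form (n : ℕ) : Set where
  var    : ℕ → Form n
  neg    : Form n → Form n
  _∧_    : Form n → Form n → Form n
  K      : Fin n → Form n → Form n
  [_]_   : Form n → Form n → Form n
  [_∣_]_ : Subset n → Form n → Form n → Form n
  [⟨_⟩]_ : Subset n → Form n → Form n

_⇒_ : ∀ {n} → Form n → Form n → Form n
φ ⇒ ψ = neg (φ ∧ neg ψ)

⟨[_]⟩_ : ∀ {n} → Subset n → Form n → Form n
⟨[ G ]⟩ φ = neg ([⟨ G ⟩] (neg φ))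

⊤ₑ : ∀ {n} → EL n
⊤ₑ = ¬ₑ (varₑ zero ∧ₑ (¬ₑ varₑ zero))

bigAnd : ∀ {n} → List (EL n) → EL n
bigAnd []       = ⊤ₑ
bigAnd (x ∷ xs) = x ∧ₑ bigAnd xs

-- the element  ⋀_{i∈G} K_i (f i)  of L_EL^G determined by a family f
conjG : ∀ {n} → Subset n → (Fin n → EL n) → EL n
conjG {n} G f = bigAnd (map (λ i → Kₑ i (f i)) (filter (_∈? G) (allFin n)))

record Model (n : ℕ) : Set₁ where
  field
    W     : Set
    R     : Fin n → W → W → Set
    R-equiv : ∀ a → IsEquivalence (R a)
    V     : ℕ → W → Set
open Model public

restrict : ∀ {n} (M : Model n) → (W M → Set) → Model n
restrict M P = record
  { W = Σ (W M) P
  ; R = λ a x y → R M a (proj₁ x) (proj₁ y)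
  ; R-equiv = λ a → record
      { refl  = IsEquivalence.refl (R-equiv M a)
      ; sym   = IsEquivalence.sym (R-equiv M a)
      ; trans = IsEquivalence.trans (R-equiv M a) }
  ; V = λ p x → V M p (proj₁ x)
  }

satEL : ∀ {n} (M : Model n) → W M → EL n → Set
satEL M w (varₑ p) = V M p w
satEL M w (¬ₑ φ)   = ¬ satEL M w φ
satEL M w (φ ∧ₑ ψ) = satEL M w φ × satEL M w ψ
satEL M w (Kₑ a φ) = ∀ v → R M a w v → satEL M v φ

sat : ∀ {n} (M : Model n) → W M → Form n → Set
sat M w (var p) = V M p w
sat M w (neg φ) = ¬ sat M w φ
sat M w (φ ∧ ψ) = sat M w φ × sat M w ψ
sat M w (K a φ) = ∀ v → R M a w v → sat M v φ
sat M w ([ ψ ] φ) =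
  (h : sat M w ψ) → sat (restrict M (λ v → sat M v ψ)) (w , h) φ
sat M w ([ G ∣ χ ] φ) =
  sat M w χ ×
  (∀ (f : Fin _ → EL _) →
     (h : satEL M w (conjG G f) × sat M w χ) →
     sat (restrict M (λ v → satEL M v (conjG G f) × sat M v χ)) (w , h) φ)
sat M w ([⟨ G ⟩] φ) =
  ∀ (f : Fin _ → EL _) → Σ (Fin _ → EL _) λ g →
    satEL M w (conjG G f) →
    ¬ ((h : satEL M w (conjG G f ∧ₑ conjG (∁ G) g)) →
       ¬ sat (restrict M (λ v → satEL M v (conjG G f ∧ₑ conjG (∁ G) g))) (w , h) φ)

Valid : ∀ {n} → Form n → Set₁
Valid {n} φ = (M : Model n) (w : W M) → sat M w φ

module Submission where

-- Read classically, ⟨[G]⟩⟨[G]⟩φ at w yields a G-announcement ψ₁ = ⋀_{i∈G} K_i f₁(i),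
-- true at w, such that whatever A∖G announces together with it, in particular the
-- challenge χ = ⋀_{i∉G} K_i f(i) of [⟨A∖G⟩]φ, the coalition G has in M^{ψ₁∧χ} a
-- second announcement ψ₂ = ⋀_{i∈G} K_i f₂(i) after which (with A∖G announcing ⊤)
-- φ holds.  The two G-announcements merge into the single announcement
-- ⋀_{i∈G} K_i (f₁ i ∧ (θ → θ-relativisation of f₂ i)),  θ = ψ₁ ∧ χ,  made in M,
-- and announcing χ together with it leaves exactly the worlds of the doubly
-- restricted model.  A bisimulation between the two models transfers φ.

open import Defs
open import Level using (0ℓ)
open import Data.Nat using (ℕ)
open import Data.Bool.Properties using (not-involutive)
open import Data.Fin using (Fin)
open import Data.Fin.Subset using (Subset; ∁; _∈_)
open import Data.Fin.Subset.Properties using (_∈?_)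
open import Data.Vec.Properties using (map-∘; map-cong; map-id)
open import Data.List using (List; []; _∷_; map; filter; allFin)
open import Data.List.Relation.Unary.Any using (here; there)
import Data.List.Membership.Propositional as List
open import Data.List.Membership.Propositional.Properties using (∈-allFin)
open import Data.Product using (Σ; _×_; _,_; proj₁; proj₂)
open import Data.Empty using (⊥-elim)
open import Relation.Nullary using (¬_; yes; no)
open import Relation.Binary.PropositionalEquality using (_≡_; refl; sym; trans; subst)
open import Axiom.ExcludedMiddle using (ExcludedMiddle)
open import Axiom.DoubleNegationElimination using (em⇒dne)

record Bisim {n : ℕ} (M N : Model n) : Set₁ where
  field
    Z     : W M → W N → Set
    atom  : ∀ {x y} → Z x y → ∀ p → V M p x → V N p y
    atomb : ∀ {x y} → Z x y → ∀ p → V N p y → V M p x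
    zig   : ∀ {x y} a x' → Z x y → R M a x x' → Σ (W N) λ y' → R N a y y' × Z x' y'
    zag   : ∀ {x y} a y' → Z x y → R N a y y' → Σ (W M) λ x' → R M a x x' × Z x' y'
open Bisim

-- The converse of a bisimulation; needed for negation, whose truth transfers
-- in the opposite direction.
flipB : ∀ {n} {M N : Model n} → Bisim M N → Bisim N M
flipB B = record
  { Z     = λ y x → Z B x y
  ; atom  = atomb B
  ; atomb = atom B
  ; zig   = zag B
  ; zag   = zig B }

-- Restricting two bisimilar models to properties respected by the bisimulation
-- yields bisimilar models; this handles the announcement operators.
restrictB : ∀ {n} {M N : Model n} (B : Bisim M N) (P : W M → Set) (Q : W N → Set) →
  (∀ {x y} → Z B x y → P x → Q y) → (∀ {x y} → Z B x y → Q y → P x) →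
  Bisim (restrict M P) (restrict N Q)
restrictB B P Q pq qp = record
  { Z     = λ x y → Z B (proj₁ x) (proj₁ y)
  ; atom  = atom B
  ; atomb = atomb B
  ; zig   = λ { a (x' , px') z r → let (y' , r' , z') = zig B a x' z r in (y' , pq z' px') , r' , z' }
  ; zag   = λ { a (y' , qy') z r → let (x' , r' , z') = zag B a y' z r in (x' , qp z' qy') , r' , z' } }

satEL→ : ∀ {n} {M N : Model n} (B : Bisim M N) {x y} → Z B x y →
  (φ : EL n) → satEL M x φ → satEL N y φ
satEL→ B z (varₑ p) s       = atom B z p s
satEL→ B z (¬ₑ φ) s t       = s (satEL→ (flipB B) z φ t)
satEL→ B z (φ ∧ₑ ψ) (s , t) = satEL→ B z φ s , satEL→ B z ψ t
satEL→ B z (Kₑ a φ) s v r   = let (x' , r' , z') = zag B a v z r in satEL→ B z' φ (s x' r')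

-- All of L_CoRGAL is invariant under bisimulation: the quantified operators
-- range over epistemic announcements, which are themselves invariant.
sat→ : ∀ {n} {M N : Model n} (B : Bisim M N) {x y} → Z B x y →
  (φ : Form n) → sat M x φ → sat N y φ
sat→ B z (var p) s       = atom B z p s
sat→ B z (neg φ) s t     = s (sat→ (flipB B) z φ t)
sat→ B z (φ ∧ ψ) (s , t) = sat→ B z φ s , sat→ B z ψ t
sat→ B z (K a φ) s v r   = let (x' , r' , z') = zag B a v z r in sat→ B z' φ (s x' r')
sat→ B z ([ ψ ] φ) s h =
  sat→ (restrictB B _ _ (λ z' → sat→ B z' ψ) (λ z' → sat→ (flipB B) z' ψ)) z φ
    (s (sat→ (flipB B) z ψ h))
sat→ B z ([ G ∣ χ ] φ) (c , s) =
  sat→ B z χ c , λ f h →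
    sat→ (restrictB B _ _ (λ z' (a , b) → satEL→ B z' (conjG G f) a , sat→ B z' χ b)
                          (λ z' (a , b) → satEL→ (flipB B) z' (conjG G f) a , sat→ (flipB B) z' χ b))
         z φ
      (s f (satEL→ (flipB B) z (conjG G f) (proj₁ h) , sat→ (flipB B) z χ (proj₂ h)))
sat→ B z ([⟨ G ⟩] φ) s f =
  let (g , k) = s f
      ψ       = conjG G f ∧ₑ conjG (∁ G) g
  in g , λ a nn → k (satEL→ (flipB B) z (conjG G f) a) λ h t →
       nn (satEL→ B z ψ h)
          (sat→ (restrictB B _ _ (λ z' → satEL→ B z' ψ) (λ z' → satEL→ (flipB B) z' ψ)) z φ t)

module _ {n : ℕ} (M : Model n) (P : W M → Set) (Q : W (restrict M P) → Set) (R : W M → Set)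
         (fwd : ∀ {v} (p : P v) → Q (v , p) → R v)
         (bwd : ∀ {v} → R v → Σ (P v) λ p → Q (v , p)) where

  compose-bisim : Bisim (restrict (restrict M P) Q) (restrict M R)
  compose-bisim = record
    { Z     = λ x y → proj₁ (proj₁ x) ≡ proj₁ y
    ; atom  = λ { refl p s → s }
    ; atomb = λ { refl p s → s }
    ; zig   = λ { a ((u , p) , q) refl r → (u , fwd p q) , r , refl }
    ; zag   = λ { a (u , ρ) refl r → ((u , proj₁ (bwd ρ)) , proj₂ (bwd ρ)) , r , refl } }

  announce-compose : ∀ {w} (p : P w) (q : Q (w , p)) (φ : Form n) →
    sat (restrict (restrict M P) Q) ((w , p) , q) φ → sat (restrict M R) (w , fwd p q) φ
  announce-compose p q φ = sat→ compose-bisim refl φ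

module _ {n : ℕ} (M : Model n) (v : W M) (S : Subset n) (f : Fin n → EL n) where

  private
    KnowsAll : List (Fin n) → Set
    KnowsAll xs = ∀ i → i List.∈ xs → i ∈ S → satEL M v (Kₑ i (f i))

    conjL : List (Fin n) → EL n
    conjL xs = bigAnd (map (λ i → Kₑ i (f i)) (filter (_∈? S) xs))

    conjL-elim : (xs : List (Fin n)) → satEL M v (conjL xs) → KnowsAll xs
    conjL-elim (x ∷ xs) s i m i∈S with x ∈? S
    conjL-elim (x ∷ xs) (s , _) i (here refl) i∈S | yes _ = s
    conjL-elim (x ∷ xs) (_ , s) i (there m)   i∈S | yes _ = conjL-elim xs s i m i∈S
    conjL-elim (x ∷ xs) s i (here refl) i∈S | no i∉S = ⊥-elim (i∉S i∈S)
    conjL-elim (x ∷ xs) s i (there m)   i∈S | no _   = conjL-elim xs s i m i∈S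

    conjL-intro : (xs : List (Fin n)) → KnowsAll xs → satEL M v (conjL xs)
    conjL-intro [] k (a , ¬a) = ¬a a
    conjL-intro (x ∷ xs) k with x ∈? S
    ... | yes x∈S = k x (here refl) x∈S , conjL-intro xs (λ i m → k i (there m))
    ... | no _    = conjL-intro xs (λ i m → k i (there m))

  conjG-elim : satEL M v (conjG S f) → ∀ i → i ∈ S → satEL M v (Kₑ i (f i))
  conjG-elim s i = conjL-elim (allFin n) s i (∈-allFin i)

  conjG-intro : (∀ i → i ∈ S → satEL M v (Kₑ i (f i))) → satEL M v (conjG S f)
  conjG-intro k = conjL-intro (allFin n) (λ i _ → k i)

conjG-map : ∀ {n} {M N : Model n} {v : W M} {u : W N} (S : Subset n) {f g : Fin n → EL n} →
  (∀ i → i ∈ S → satEL M v (Kₑ i (f i)) → satEL N u (Kₑ i (g i))) →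
  satEL M v (conjG S f) → satEL N u (conjG S g)
conjG-map {M = M} {N} {v} {u} S {f} {g} h s =
  conjG-intro N u S g λ i i∈S → h i i∈S (conjG-elim M v S f s i i∈S)

conjG-⊤ : ∀ {n} (M : Model n) (v : W M) (S : Subset n) → satEL M v (conjG S (λ _ → ⊤ₑ))
conjG-⊤ M v S = conjG-intro M v S _ (λ i _ u r (a , ¬a) → ¬a a)

∁-involutive : ∀ {n} (G : Subset n) → ∁ (∁ G) ≡ G
∁-involutive G = trans (sym (map-∘ _ _ G)) (trans (map-cong not-involutive G) (map-id G))

-- [⟨A∖G⟩] quantifies over announcements of ∁ (∁ G); these are the
-- announcements of G.
conjG-∁∁ : ∀ {n} (M : Model n) (v : W M) (G : Subset n) {g : Fin n → EL n} →
  satEL M v (conjG G g) → satEL M v (conjG (∁ (∁ G)) g)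
conjG-∁∁ M v G {g} = subst (λ S → satEL M v (conjG S g)) (sym (∁-involutive G))

conjG-∁∁⁻¹ : ∀ {n} (M : Model n) (v : W M) (G : Subset n) {g : Fin n → EL n} →
  satEL M v (conjG (∁ (∁ G)) g) → satEL M v (conjG G g)
conjG-∁∁⁻¹ M v G {g} = subst (λ S → satEL M v (conjG S g)) (∁-involutive G)

-- Implication and relativisation of epistemic formulas: relEL θ φ expresses in M
-- what φ expresses in M^θ (every knowledge operator is restricted to θ-worlds).
_⇒ₑ_ : ∀ {n} → EL n → EL n → EL n
a ⇒ₑ b = ¬ₑ (a ∧ₑ (¬ₑ b))

relEL : ∀ {n} → EL n → EL n → EL n
relEL θ (varₑ p) = varₑ p
relEL θ (¬ₑ φ)   = ¬ₑ (relEL θ φ)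
relEL θ (φ ∧ₑ ψ) = relEL θ φ ∧ₑ relEL θ ψ
relEL θ (Kₑ a φ) = Kₑ a (θ ⇒ₑ relEL θ φ)

-- The announcement that merges two successive G-announcements f₁ (in M) and
-- f₂ (in M^θ) into one made in M.
merged : ∀ {n} → EL n → (Fin n → EL n) → (Fin n → EL n) → Fin n → EL n
merged θ f₁ f₂ i = f₁ i ∧ₑ (θ ⇒ₑ relEL θ (f₂ i))

-- The remaining facts use excluded middle: the semantics of ⟨[G]⟩ and of
-- knowledge in a restricted model is only classically equivalent to its
-- intended positive reading.
module Classical (em : ExcludedMiddle 0ℓ) where

  dne : {P : Set} → ¬ ¬ P → P
  dne = em⇒dne em

  ¬∀⇒∃¬ : {A : Set} {P : A → Set} → ¬ (∀ x → P x) → Σ A λ x → ¬ P x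
  ¬∀⇒∃¬ {A} {P} ¬∀ with em {Σ A λ x → ¬ P x}
  ... | yes ∃¬ = ∃¬
  ... | no ¬∃¬ = ⊥-elim (¬∀ λ x → dne λ ¬Px → ¬∃¬ (x , ¬Px))

  ¬[→¬]⇒× : {P Q : Set} → ¬ (P → ¬ Q) → P × Q
  ¬[→¬]⇒× h = dne (λ ¬p → h λ p → ⊥-elim (¬p p)) , dne (λ ¬q → h λ _ → ¬q)

  module _ {n : ℕ} (M : Model n) (θ : EL n) where
    private
      Mθ : Model n
      Mθ = restrict M (λ v → satEL M v θ)

    relativise   : (φ : EL n) (x : W Mθ) → satEL Mθ x φ → satEL M (proj₁ x) (relEL θ φ)
    unrelativise : (φ : EL n) (x : W Mθ) → satEL M (proj₁ x) (relEL θ φ) → satEL Mθ x φ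
    relativise (varₑ p) x s = s
    relativise (¬ₑ φ) x s t = s (unrelativise φ x t)
    relativise (φ ∧ₑ ψ) x (s , t) = relativise φ x s , relativise ψ x t
    relativise (Kₑ a φ) x s u r (θu , ¬rel) = ¬rel (relativise φ (u , θu) (s (u , θu) r))
    unrelativise (varₑ p) x s = s
    unrelativise (¬ₑ φ) x s t = s (relativise φ x t)
    unrelativise (φ ∧ₑ ψ) x (s , t) = unrelativise φ x s , unrelativise ψ x t
    unrelativise (Kₑ a φ) x s (u , θu) r = unrelativise φ (u , θu) (dne λ ¬rel → s u r (θu , ¬rel))

    merge-intro : (S : Subset n) (f₁ f₂ : Fin n → EL n) (x : W Mθ) →
      satEL M (proj₁ x) (conjG S f₁) → satEL Mθ x (conjG S f₂) →
      satEL M (proj₁ x) (conjG S (merged θ f₁ f₂))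
    merge-intro S f₁ f₂ x s₁ s₂ = conjG-intro M (proj₁ x) S _ λ i i∈S u r →
      conjG-elim M (proj₁ x) S f₁ s₁ i i∈S u r ,
      λ (θu , ¬rel) → ¬rel (relativise (f₂ i) (u , θu) (conjG-elim Mθ x S f₂ s₂ i i∈S (u , θu) r))

    merge-first : (S : Subset n) (f₁ f₂ : Fin n → EL n) {v : W M} →
      satEL M v (conjG S (merged θ f₁ f₂)) → satEL M v (conjG S f₁)
    merge-first S f₁ f₂ = conjG-map S λ i _ k u r → proj₁ (k u r)

    merge-second : (S : Subset n) (f₁ f₂ : Fin n → EL n) (x : W Mθ) →
      satEL M (proj₁ x) (conjG S (merged θ f₁ f₂)) → satEL Mθ x (conjG S f₂)
    merge-second S f₁ f₂ x = conjG-map S λ i _ k (u , θu) r →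
      unrelativise (f₂ i) (u , θu) (dne λ ¬rel → proj₂ (k u r) (θu , ¬rel))

  diamond-elim : ∀ {n} (M : Model n) (w : W M) (G : Subset n) (ψ : Form n) →
    sat M w (⟨[ G ]⟩ ψ) →
    Σ (Fin n → EL n) λ f → ∀ g → satEL M w (conjG G f) ×
      ((h : satEL M w (conjG G f ∧ₑ conjG (∁ G) g)) →
       sat (restrict M (λ v → satEL M v (conjG G f ∧ₑ conjG (∁ G) g))) (w , h) ψ)
  diamond-elim M w G ψ s =
    let (f , ¬resp) = ¬∀⇒∃¬ s
    in f , λ g → let (ψ₁ , ψ-after) = ¬[→¬]⇒× (λ answer → ¬resp (g , answer)) in
                 ψ₁ , λ h → dne (ψ-after h)

  respond : ∀ {n} (G : Subset n) (φ : Form n) (M : Model n) (w : W M) →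
    sat M w (⟨[ G ]⟩ (⟨[ G ]⟩ φ)) → (f : Fin n → EL n) → satEL M w (conjG (∁ G) f) →
    Σ (Fin n → EL n) λ g → Σ (satEL M w (conjG (∁ G) f ∧ₑ conjG (∁ (∁ G)) g)) λ h →
      sat (restrict M (λ v → satEL M v (conjG (∁ G) f ∧ₑ conjG (∁ (∁ G)) g))) (w , h) φ
  respond {n} G φ M w hyp f χ = g , fwd h₁ h₂ , announce-compose M Θ Ψ T fwd bwd h₁ h₂ φ φ-holds
    where
    f₁ : Fin n → EL n
    f₁ = proj₁ (diamond-elim M w G (⟨[ G ]⟩ φ) hyp)
    θ : EL n
    θ = conjG G f₁ ∧ₑ conjG (∁ G) f
    Θ : W M → Set
    Θ v = satEL M v θ
    h₁ : Θ w
    h₁ = proj₁ (proj₂ (diamond-elim M w G (⟨[ G ]⟩ φ) hyp) f) , χ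
    Mθ : Model n
    Mθ = restrict M Θ
    after-first : sat Mθ (w , h₁) (⟨[ G ]⟩ φ)
    after-first = proj₂ (proj₂ (diamond-elim M w G (⟨[ G ]⟩ φ) hyp) f) h₁
    -- G's second announcement in M^θ, met by the trivial announcement of A∖G
    trivial : Fin n → EL n
    trivial _ = ⊤ₑ
    f₂ : Fin n → EL n
    f₂ = proj₁ (diamond-elim Mθ (w , h₁) G φ after-first)
    ψ₂ : EL n
    ψ₂ = conjG G f₂ ∧ₑ conjG (∁ G) trivial
    Ψ : W Mθ → Set
    Ψ x = satEL Mθ x ψ₂
    h₂ : Ψ (w , h₁)
    h₂ = proj₁ (proj₂ (diamond-elim Mθ (w , h₁) G φ after-first) trivial) , conjG-⊤ Mθ (w , h₁) (∁ G)
    φ-holds : sat (restrict Mθ Ψ) ((w , h₁) , h₂) φ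
    φ-holds = proj₂ (proj₂ (diamond-elim Mθ (w , h₁) G φ after-first) trivial) h₂
    g : Fin n → EL n
    g = merged θ f₁ f₂
    T : W M → Set
    T v = satEL M v (conjG (∁ G) f ∧ₑ conjG (∁ (∁ G)) g)
    fwd : ∀ {v} (p : Θ v) → Ψ (v , p) → T v
    fwd {v} p q = proj₂ p , conjG-∁∁ M v G (merge-intro M θ G f₁ f₂ (v , p) (proj₁ p) (proj₁ q))
    bwd : ∀ {v} → T v → Σ (Θ v) λ p → Ψ (v , p)
    bwd {v} (χv , gv) =
      let gv′ = conjG-∁∁⁻¹ M v G gv
          p   = merge-first M θ G f₁ f₂ gv′ , χv
      in p , merge-second M θ G f₁ f₂ (v , p) gv′ , conjG-⊤ Mθ (v , p) (∁ G)

proposition5 : ExcludedMiddle 0ℓ → {n : ℕ} (G : Subset n) (φ : Form n) →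
    Valid ((⟨[ G ]⟩ (⟨[ G ]⟩ φ)) ⇒ ([⟨ ∁ G ⟩] φ))
proposition5 em G φ M w (hyp , refuted) = refuted answer
  where
  open Classical em
  answer : sat M w ([⟨ ∁ G ⟩] φ)
  answer f with em {satEL M w (conjG (∁ G) f)}
  ... | no ¬χ = (λ _ → ⊤ₑ) , λ χ → ⊥-elim (¬χ χ)
  ... | yes χ = let (g , h , φ-holds) = respond G φ M w hyp f χ in g , λ _ ¬φ → ¬φ h φ-holds
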